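{- A positive integer $n$ satisfies $$\sigma_2(n)-n^2=\sum_{d\mid n,\ d<n} d^2 = 3n$$ if and only if $n=F_{2k-1}F_{2k+1}$ for some integer $k\geq 1$ such that both $F_{2k-1}$ and $F_{2k+1}$ are prime numbers.
   Context: $\sigma_2(n)=\sum_{d\mid n} d^2$ is the sum of squares of the positive divisors of $n$. $F_m$ denotes the $m$-th Fibonacci number: $F_1=F_2=1$, $F_{m+1}=F_m+F_{m-1}$. -}

module Defs where

open import Data.Nat using (ℕ; zero; suc; _+_; _*_; _^_)
open import Data.Nat.Divisibility using (_∣?_)
open import Data.List using (List; map; filter; upTo)
open import Data.Nat.ListAction using (sum)

-- divisors of n: the d ∈ {1,…,n} with d ∣ n (empty for n = 0)
divisors : ℕ → List ℕ
divisors n = filter (_∣? n) (map suc (upTo n))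

σ₂ : ℕ → ℕ
σ₂ n = sum (map (λ d → d ^ 2) (divisors n))

fib : ℕ → ℕ
fib zero = zero
fib (suc zero) = suc zero
fib (suc (suc m)) = fib (suc m) + fib m

{-# OPTIONS --safe #-}
module Submission where

-- Write n = a·b with a the least non-trivial divisor of n. Then σ₂(n) − n² ≥ 1 + b², so
-- 3ab = σ₂(n) − n² forces b < 3a; since b has no divisor below a, b is prime (apart from
-- n = 8, which fails). So n = p·q with primes p ≤ q, and p = q is impossible, while for
-- p < q the equation reads 1 + p² + q² = 3pq: (1, p, q) is a Markov triple. Vieta jumping
-- (p, q) ↦ (3p − q, p) descends to (1, 2), and since F(m) + F(m+4) = 3·F(m+2), the same
-- jump run upwards from (1, 2) produces exactly the pairs (F(2k−1), F(2k+1)).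

open import Defs
open import Data.Nat
open import Data.Nat.Properties
open import Data.Nat.Divisibility
open import Data.Nat.Primality
open import Data.Nat.Coprimality using (Coprime; coprime-divisor)
open import Data.Nat.ListAction using (sum)
open import Data.Nat.ListAction.Properties using (sum-++)
open import Data.Nat.Tactic.RingSolver using (solve-∀)
open import Data.List using (List; map; filter; upTo; _++_; [_])
open import Data.List.Properties using (upTo-∷ʳ; map-++; filter-++; filter-accept; filter-reject)
open import Data.Product using (∃-syntax; ∃₂; _×_; _,_)
open import Data.Sum using (_⊎_; inj₁; inj₂)
open import Function.Bundles using (_⇔_; mk⇔)
open import Data.Nat.Induction using (<-wellFounded)
open import Induction.WellFounded using (Acc; acc)
open import Relation.Binary.PropositionalEquality
  using (_≡_; _≢_; refl; sym; trans; cong; cong₂; subst; subst₂; module ≡-Reasoning)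
open import Relation.Nullary using (yes; no; contradiction)
open import Relation.Nullary.Decidable using (from-yes)

sumSquares : List ℕ → ℕ
sumSquares ds = sum (map (_^ 2) ds)

sumSquares-++ : ∀ ds es → sumSquares (ds ++ es) ≡ sumSquares ds + sumSquares es
sumSquares-++ ds es = trans (cong sum (map-++ (_^ 2) ds es)) (sum-++ (map (_^ 2) ds) _)

σ₂≤ : ℕ → ℕ → ℕ
σ₂≤ n m = sumSquares (filter (_∣? n) (map suc (upTo m)))

σ₂< : ℕ → ℕ
σ₂< n = σ₂≤ n (pred n)

σ₂≤-suc : ∀ n m → σ₂≤ n (suc m) ≡ σ₂≤ n m + sumSquares (filter (_∣? n) [ suc m ])
σ₂≤-suc n m = begin
  σ₂≤ n (suc m)
    ≡⟨ cong (λ ds → sumSquares (filter (_∣? n) ds))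
            (trans (cong (map suc) (sym (upTo-∷ʳ m))) (map-++ suc (upTo m) [ m ])) ⟩
  sumSquares (filter (_∣? n) (map suc (upTo m) ++ [ suc m ]))
    ≡⟨ cong sumSquares (filter-++ (_∣? n) (map suc (upTo m)) [ suc m ]) ⟩
  sumSquares (filter (_∣? n) (map suc (upTo m)) ++ filter (_∣? n) [ suc m ])
    ≡⟨ sumSquares-++ (filter (_∣? n) (map suc (upTo m))) _ ⟩
  σ₂≤ n m + sumSquares (filter (_∣? n) [ suc m ]) ∎
  where open ≡-Reasoning

σ₂≤-suc-∣ : ∀ {n m} → suc m ∣ n → σ₂≤ n (suc m) ≡ σ₂≤ n m + suc m * suc m
σ₂≤-suc-∣ {n} {m} d∣n = begin
  σ₂≤ n (suc m)
    ≡⟨ σ₂≤-suc n m ⟩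
  σ₂≤ n m + sumSquares (filter (_∣? n) [ suc m ])
    ≡⟨ cong (λ ds → σ₂≤ n m + sumSquares ds) (filter-accept (_∣? n) d∣n) ⟩
  σ₂≤ n m + (suc m * (suc m * 1) + 0)
    ≡⟨ cong (σ₂≤ n m +_) (trans (+-identityʳ _) (cong (suc m *_) (*-identityʳ (suc m)))) ⟩
  σ₂≤ n m + suc m * suc m ∎
  where open ≡-Reasoning

σ₂≤-suc-∤ : ∀ {n m} → suc m ∤ n → σ₂≤ n (suc m) ≡ σ₂≤ n m
σ₂≤-suc-∤ {n} {m} d∤n = begin
  σ₂≤ n (suc m)
    ≡⟨ σ₂≤-suc n m ⟩
  σ₂≤ n m + sumSquares (filter (_∣? n) [ suc m ])
    ≡⟨ cong (λ ds → σ₂≤ n m + sumSquares ds) (filter-reject (_∣? n) d∤n) ⟩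
  σ₂≤ n m + 0
    ≡⟨ +-identityʳ _ ⟩
  σ₂≤ n m ∎
  where open ≡-Reasoning

σ₂≤-skip : ∀ {n lo hi} → lo ≤ hi → (∀ {c} → lo < c → c ≤ hi → c ∤ n) →
  σ₂≤ n hi ≡ σ₂≤ n lo
σ₂≤-skip {hi = zero} z≤n _ = refl
σ₂≤-skip {hi = suc hi} lo≤1+hi none with m≤n⇒m<n∨m≡n lo≤1+hi
... | inj₂ refl = refl
... | inj₁ lo<1+hi = trans (σ₂≤-suc-∤ (none lo<1+hi ≤-refl))
  (σ₂≤-skip (s≤s⁻¹ lo<1+hi) (λ lo<c c≤hi → none lo<c (m≤n⇒m≤1+n c≤hi)))

σ₂≤-jump : ∀ {n lo d} → lo < d → d ∣ n → (∀ {c} → lo < c → c < d → c ∤ n) →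
  σ₂≤ n d ≡ σ₂≤ n lo + d * d
σ₂≤-jump {d = suc d} lo<d d∣n none =
  trans (σ₂≤-suc-∣ d∣n)
        (cong (_+ suc d * suc d) (σ₂≤-skip (s≤s⁻¹ lo<d) (λ lo<c c≤d → none lo<c (s≤s c≤d))))

σ₂≤-mono : ∀ {n lo hi} → lo ≤ hi → σ₂≤ n lo ≤ σ₂≤ n hi
σ₂≤-mono {hi = zero} z≤n = ≤-refl
σ₂≤-mono {n} {lo} {suc hi} lo≤1+hi with m≤n⇒m<n∨m≡n lo≤1+hi
... | inj₂ refl = ≤-refl
... | inj₁ lo<1+hi = begin
  σ₂≤ n lo ≤⟨ σ₂≤-mono (s≤s⁻¹ lo<1+hi) ⟩
  σ₂≤ n hi ≤⟨ m≤m+n _ _ ⟩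
  σ₂≤ n hi + _ ≡⟨ σ₂≤-suc n hi ⟨
  σ₂≤ n (suc hi) ∎
  where open ≤-Reasoning

σ₂≤-1 : ∀ n → σ₂≤ n 1 ≡ 1
σ₂≤-1 n = σ₂≤-suc-∣ (1∣ n)

σ₂<-skip : ∀ {n lo} → lo < n → (∀ {c} → lo < c → c < n → c ∤ n) → σ₂< n ≡ σ₂≤ n lo
σ₂<-skip {suc n} lo<n none = σ₂≤-skip {suc n} (s≤s⁻¹ lo<n) (λ lo<c c≤n → none lo<c (s≤s c≤n))

σ₂∸n²≡σ₂< : ∀ {n} → 0 < n → σ₂ n ∸ n ^ 2 ≡ σ₂< n
σ₂∸n²≡σ₂< {n@(suc m)} _ = begin
  σ₂≤ n n ∸ n * (n * 1)   ≡⟨ cong₂ _∸_ (σ₂≤-suc-∣ {n} {m} ∣-refl) (cong (n *_) (*-identityʳ n)) ⟩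
  σ₂≤ n m + n * n ∸ n * n ≡⟨ m+n∸n≡m (σ₂≤ n m) (n * n) ⟩
  σ₂≤ n m                 ∎
  where open ≡-Reasoning

1+d*d≤σ₂< : ∀ {n d} → 1 < d → d < n → d ∣ n → 1 + d * d ≤ σ₂< n
1+d*d≤σ₂< {suc n} {d@(suc d′)} (s≤s 1≤d′) (s≤s d≤n) d∣n = begin
  1 + d * d ≡⟨ cong (_+ d * d) (σ₂≤-1 (suc n)) ⟨
  σ₂≤ (suc n) 1 + d * d ≤⟨ +-monoˡ-≤ (d * d) (σ₂≤-mono {suc n} 1≤d′) ⟩
  σ₂≤ (suc n) d′ + d * d ≡⟨ σ₂≤-suc-∣ d∣n ⟨
  σ₂≤ (suc n) d ≤⟨ σ₂≤-mono {suc n} d≤n ⟩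
  σ₂≤ (suc n) n ∎
  where open ≤-Reasoning

prime∤⇒coprime : ∀ {p d} → Prime p → p ∤ d → Coprime d p
prime∤⇒coprime pp p∤d (c∣d , c∣p) with prime⇒irreducible pp c∣p
... | inj₁ c≡1 = c≡1
... | inj₂ refl = contradiction c∣d p∤d

∣prime*prime : ∀ {p q d} → Prime p → Prime q → d ∣ p * q →
  d ≡ 1 ⊎ d ≡ p ⊎ d ≡ q ⊎ d ≡ p * q
∣prime*prime {p} {q} pp pq d∣pq with p ∣? _
... | no p∤d with prime⇒irreducible pq (coprime-divisor (prime∤⇒coprime pp p∤d) d∣pq)
...   | inj₁ d≡1 = inj₁ d≡1
...   | inj₂ d≡q = inj₂ (inj₂ (inj₁ d≡q))
∣prime*prime {p} {q} pp pq d∣pq | yes (divides e refl)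
  with prime⇒irreducible pq (*-cancelˡ-∣ p {{prime⇒nonZero pp}} (subst (_∣ p * q) (*-comm e p) d∣pq))
... | inj₁ refl = inj₂ (inj₁ (*-identityˡ p))
... | inj₂ refl = inj₂ (inj₂ (inj₂ (*-comm q p)))

∤prime*prime : ∀ {p q c} → Prime p → Prime q → 1 < c → c < p * q → c ≢ p → c ≢ q →
  c ∤ p * q
∤prime*prime pp pq 1<c c<pq c≢p c≢q c∣pq with ∣prime*prime pp pq c∣pq
... | inj₁ c≡1 = >⇒≢ 1<c c≡1
... | inj₂ (inj₁ c≡p) = c≢p c≡p
... | inj₂ (inj₂ (inj₁ c≡q)) = c≢q c≡q
... | inj₂ (inj₂ (inj₂ c≡pq)) = <⇒≢ c<pq c≡pq

prime⇒>1 : ∀ {p} → Prime p → 1 < p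
prime⇒>1 {p} pp = nonTrivial⇒n>1 p {{prime⇒nonTrivial pp}}

q<p*q : ∀ {p q} → Prime p → Prime q → q < p * q
q<p*q {p} {q} pp pq = subst (q <_) (*-comm q p) (m<m*n q p {{prime⇒nonZero pq}} (prime⇒>1 pp))

σ₂<-prime : ∀ {p} → Prime p → σ₂< p ≡ 1
σ₂<-prime {p} pp = trans (σ₂<-skip (prime⇒>1 pp) no-divisor) (σ₂≤-1 p)
  where
  no-divisor : ∀ {c} → 1 < c → c < p → c ∤ p
  no-divisor 1<c c<p c∣p = Prime.notComposite pp (hasNonTrivialDivisor {{n>1⇒nonTrivial 1<c}} c<p c∣p)

σ₂<-prime*prime : ∀ {p q} → Prime p → Prime q → p < q → σ₂< (p * q) ≡ 1 + p * p + q * q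
σ₂<-prime*prime {p} {q} pp pq p<q = begin
  σ₂< (p * q)
    ≡⟨ σ₂<-skip q<pq (λ q<c c<pq →
         ∤pq (<-trans 1<q q<c) c<pq (>⇒≢ (<-trans p<q q<c)) (>⇒≢ q<c)) ⟩
  σ₂≤ (p * q) q
    ≡⟨ σ₂≤-jump p<q (n∣m*n p) (λ p<c c<q →
         ∤pq (<-trans 1<p p<c) (<-trans c<q q<pq) (>⇒≢ p<c) (<⇒≢ c<q)) ⟩
  σ₂≤ (p * q) p + q * q
    ≡⟨ cong (_+ q * q) (σ₂≤-jump 1<p (m∣m*n q) (λ 1<c c<p →
         ∤pq 1<c (<-trans c<p p<pq) (<⇒≢ c<p) (<⇒≢ (<-trans c<p p<q)))) ⟩
  σ₂≤ (p * q) 1 + p * p + q * q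
    ≡⟨ cong (λ s → s + p * p + q * q) (σ₂≤-1 (p * q)) ⟩
  1 + p * p + q * q ∎
  where
  open ≡-Reasoning
  ∤pq : ∀ {c} → 1 < c → c < p * q → c ≢ p → c ≢ q → c ∤ p * q
  ∤pq = ∤prime*prime pp pq
  1<p : 1 < p
  1<p = prime⇒>1 pp
  1<q : 1 < q
  1<q = prime⇒>1 pq
  q<pq : q < p * q
  q<pq = q<p*q pp pq
  p<pq : p < p * q
  p<pq = <-trans p<q q<pq

σ₂<-prime² : ∀ {p} → Prime p → σ₂< (p * p) ≡ 1 + p * p
σ₂<-prime² {p} pp = begin
  σ₂< (p * p)
    ≡⟨ σ₂<-skip p<pp (λ p<c c<pp → ∤pp (<-trans 1<p p<c) c<pp (>⇒≢ p<c) (>⇒≢ p<c)) ⟩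
  σ₂≤ (p * p) p
    ≡⟨ σ₂≤-jump 1<p (m∣m*n p) (λ 1<c c<p →
         ∤pp 1<c (<-trans c<p p<pp) (<⇒≢ c<p) (<⇒≢ c<p)) ⟩
  σ₂≤ (p * p) 1 + p * p
    ≡⟨ cong (_+ p * p) (σ₂≤-1 (p * p)) ⟩
  1 + p * p ∎
  where
  open ≡-Reasoning
  ∤pp : ∀ {c} → 1 < c → c < p * p → c ≢ p → c ≢ p → c ∤ p * p
  ∤pp = ∤prime*prime pp pp
  1<p : 1 < p
  1<p = prime⇒>1 pp
  p<pp : p < p * p
  p<pp = q<p*q pp pp

leastNontrivialDivisor : ∀ {n} → 1 < n → ∃[ a ] (1 < a × a ∣ n × a Rough n)
leastNontrivialDivisor {n} 1<n = search 2 (n ∸ 2) (m+[n∸m]≡n 1<n) ≤-refl 2-rough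
  where
  search : ∀ m k → m + k ≡ n → 1 < m → m Rough n → ∃[ a ] (1 < a × a ∣ n × a Rough n)
  search m k m+k≡n 1<m rough with m ∣? n
  ... | yes m∣n = m , 1<m , m∣n , rough
  search m zero m+0≡n 1<m rough | no m∤n =
    contradiction (subst (m ∣_) (trans (sym (+-identityʳ m)) m+0≡n) ∣-refl) m∤n
  search m (suc k) m+1+k≡n 1<m rough | no m∤n =
    search (suc m) k (trans (sym (+-suc m k)) m+1+k≡n) (m<n⇒m<1+n 1<m) (∤⇒rough-suc m∤n rough)

rough∧<3*⇒prime : ∀ {a b} → 1 < a → a Rough b → 1 < b → b < 3 * a →
  Prime b ⊎ (a ≡ 2 × b ≡ 4)
rough∧<3*⇒prime {1} (s≤s ()) _ _ _
rough∧<3*⇒prime {2} {1} _ _ (s≤s ()) _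
rough∧<3*⇒prime {2} {2} _ _ _ _ = inj₁ (from-yes (prime? 2))
rough∧<3*⇒prime {2} {3} _ _ _ _ = inj₁ (from-yes (prime? 3))
rough∧<3*⇒prime {2} {4} _ _ _ _ = inj₂ (refl , refl)
rough∧<3*⇒prime {2} {5} _ _ _ _ = inj₁ (from-yes (prime? 5))
rough∧<3*⇒prime {2} {suc (suc (suc (suc (suc (suc _)))))} _ _ _
  (s≤s (s≤s (s≤s (s≤s (s≤s (s≤s ()))))))
rough∧<3*⇒prime {a@(suc (suc (suc _)))} {b} _ rough 1<b b<3a =
  inj₁ (rough∧square>⇒prime {{n>1⇒nonTrivial 1<b}} rough
         (<-≤-trans b<3a (*-monoˡ-≤ a {3} {a} (s≤s (s≤s (s≤s z≤n))))))

cofactor<3* : ∀ {n a b} → 1 < a → 1 < b → n ≡ a * b → σ₂< n ≡ 3 * n → b < 3 * a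
cofactor<3* {n} {a} {b} 1<a 1<b n≡ab eq = *-cancelʳ-< b b (3 * a) (begin-strict
  b * b         <⟨ n<1+n (b * b) ⟩
  1 + b * b     ≤⟨ 1+d*d≤σ₂< 1<b b<n (divides a n≡ab) ⟩
  σ₂< n         ≡⟨ eq ⟩
  3 * n         ≡⟨ cong (3 *_) n≡ab ⟩
  3 * (a * b)   ≡⟨ *-assoc 3 a b ⟨
  3 * a * b     ∎)
  where
  open ≤-Reasoning
  b<n : b < n
  b<n = subst (b <_) (trans (*-comm b a) (sym n≡ab)) (m<m*n b a {{>-nonZero (<-trans z<s 1<b)}} 1<a)

σ₂<≡3*⇒semiprime : ∀ {n} → 0 < n → σ₂< n ≡ 3 * n →
  ∃₂ λ p q → Prime p × Prime q × p ≤ q × n ≡ p * q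
σ₂<≡3*⇒semiprime {1} _ ()
σ₂<≡3*⇒semiprime {n@(suc (suc _))} _ eq with leastNontrivialDivisor {n} (s≤s (s≤s z≤n))
... | a , 1<a , a∣n , rough with m≤n⇒m<n∨m≡n (∣⇒≤ a∣n)
... | inj₂ refl =
  contradiction (trans (sym (σ₂<-prime (rough∧∣⇒prime {{n>1⇒nonTrivial 1<a}} rough a∣n))) eq) λ ()
... | inj₁ a<n with quotient a∣n | m∣n⇒n≡m*quotient a∣n | quotient-∣ a∣n | quotient>1 a∣n a<n
... | b | n≡ab | b∣n | 1<b
  with rough∧<3*⇒prime 1<a (rough∧∣⇒rough rough b∣n) 1<b (cofactor<3* 1<a 1<b n≡ab eq)
... | inj₁ pb = a , b , rough∧∣⇒prime {{n>1⇒nonTrivial 1<a}} rough a∣n , pb ,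
                rough⇒≤ {{n>1⇒nonTrivial 1<b}} (rough∧∣⇒rough rough b∣n) , n≡ab
-- n = 8, where σ₂< 8 = 21 ≠ 24.
... | inj₂ (refl , refl) = contradiction (subst (λ m → σ₂< m ≡ 3 * m) n≡ab eq) λ ()

-- (1, x, y) is a solution of Markov's equation a² + b² + c² = 3abc.
record MarkovPair (x y : ℕ) : Set where
  constructor markov
  field equation : 1 + x * x + y * y ≡ 3 * (x * y)

markovPair-sym : ∀ {x y} → MarkovPair x y → MarkovPair y x
markovPair-sym {x} {y} (markov eq) =
  markov (trans (cong suc (+-comm (y * y) (x * x))) (trans eq (cong (3 *_) (*-comm x y))))

markovPair⇒≤3* : ∀ {x y} → MarkovPair x (suc y) → suc y ≤ 3 * x
markovPair⇒≤3* {x} {y} (markov eq) = *-cancelʳ-≤ (suc y) (3 * x) (suc y) (begin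
  suc y * suc y                   ≤⟨ m≤n+m (suc y * suc y) (1 + x * x) ⟩
  1 + x * x + suc y * suc y       ≡⟨ eq ⟩
  3 * (x * suc y)                 ≡⟨ *-assoc 3 x (suc y) ⟨
  3 * x * suc y                   ∎)
  where open ≤-Reasoning

-- y and z are the two roots of t² − 3xt + (1 + x²).
markovPair-vieta-* : ∀ {x y z} → MarkovPair x y → y + z ≡ 3 * x → y * z ≡ 1 + x * x
markovPair-vieta-* {x} {y} {z} (markov eq) y+z≡3x = +-cancelʳ-≡ (y * y) (y * z) (1 + x * x) (begin
  y * z + y * y     ≡⟨ *-distribˡ-+ y z y ⟨
  y * (z + y)       ≡⟨ cong (y *_) (trans (+-comm z y) y+z≡3x) ⟩
  y * (3 * x)       ≡⟨ y*[3*x]≡3*[x*y] x y ⟩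
  3 * (x * y)       ≡⟨ eq ⟨
  1 + x * x + y * y ∎)
  where
  open ≡-Reasoning
  y*[3*x]≡3*[x*y] : ∀ x y → y * (3 * x) ≡ 3 * (x * y)
  y*[3*x]≡3*[x*y] = solve-∀

markovPair-vieta : ∀ {x y z} → MarkovPair x y → y + z ≡ 3 * x → MarkovPair x z
markovPair-vieta {x} {y} {z} mp y+z≡3x = markov (begin
  1 + x * x + z * z ≡⟨ cong (_+ z * z) (markovPair-vieta-* mp y+z≡3x) ⟨
  y * z + z * z     ≡⟨ *-distribʳ-+ z y z ⟨
  (y + z) * z       ≡⟨ cong (_* z) y+z≡3x ⟩
  3 * x * z         ≡⟨ *-assoc 3 x z ⟩
  3 * (x * z)       ∎)
  where open ≡-Reasoning

markovPair-descent : ∀ {x y} → 1 < x → x < y → MarkovPair x y →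
  ∃[ z ] (z < x × y + z ≡ 3 * x × MarkovPair z x)
markovPair-descent {x} {y@(suc _)} 1<x x<y mp =
  z , z<x , y+z≡3x , markovPair-sym (markovPair-vieta mp y+z≡3x)
  where
  z : ℕ
  z = 3 * x ∸ y
  y+z≡3x : y + z ≡ 3 * x
  y+z≡3x = m+[n∸m]≡n (markovPair⇒≤3* mp)
  z<x : z < x
  z<x = *-cancelˡ-< y z x (begin-strict
    y * z      ≡⟨ markovPair-vieta-* mp y+z≡3x ⟩
    1 + x * x  <⟨ +-monoˡ-< (x * x) 1<x ⟩
    x + x * x  ≡⟨ *-suc x x ⟨
    x * suc x  ≤⟨ *-monoʳ-≤ x x<y ⟩
    x * y      ≡⟨ *-comm x y ⟩
    y * x      ∎)
    where open ≤-Reasoning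

fib[1+m]>0 : ∀ m → 0 < fib (suc m)
fib[1+m]>0 zero = z<s
fib[1+m]>0 (suc m) = <-≤-trans (fib[1+m]>0 m) (m≤m+n _ _)

fib[1+m]<fib[3+m] : ∀ m → fib (suc m) < fib (3 + m)
fib[1+m]<fib[3+m] m = m<n+m (fib (suc m)) (fib[1+m]>0 (suc m))

fib[m]+fib[4+m]≡3*fib[2+m] : ∀ m → fib m + fib (4 + m) ≡ 3 * fib (2 + m)
fib[m]+fib[4+m]≡3*fib[2+m] m = identity (fib (suc m)) (fib m)
  where
  identity : ∀ a b → b + (((a + b) + a) + (a + b)) ≡ 3 * (a + b)
  identity = solve-∀

fib-+2*suc : ∀ i j → fib (i + 2 * suc j) ≡ fib (i + (2 + 2 * j))
fib-+2*suc i j = cong (λ k → fib (i + k)) (*-suc 2 j)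

oddFibs-markovPair : ∀ j → MarkovPair (fib (1 + 2 * j)) (fib (3 + 2 * j))
oddFibs-markovPair zero = markov refl
oddFibs-markovPair (suc j) = subst₂ MarkovPair (sym (fib-+2*suc 1 j)) (sym (fib-+2*suc 3 j))
  (markovPair-vieta (markovPair-sym (oddFibs-markovPair j)) (fib[m]+fib[4+m]≡3*fib[2+m] (1 + 2 * j)))

markovPair⇒oddFibs : ∀ {x y} → Acc _<_ x → x < y → MarkovPair x y →
  ∃[ j ] (x ≡ fib (1 + 2 * j) × y ≡ fib (3 + 2 * j))
markovPair⇒oddFibs {0} _ _ (markov ())
markovPair⇒oddFibs {1} {1} _ (s≤s ()) _
markovPair⇒oddFibs {1} {2} _ _ _ = 0 , refl , refl
markovPair⇒oddFibs {1} {3} _ _ (markov ())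
markovPair⇒oddFibs {1} {suc (suc (suc (suc _)))} _ _ mp with markovPair⇒≤3* mp
... | s≤s (s≤s (s≤s ()))
markovPair⇒oddFibs {x@(suc (suc _))} {y} (acc rs) x<y mp with markovPair-descent (s≤s (s≤s z≤n)) x<y mp
... | z , z<x , y+z≡3x , mp′ with markovPair⇒oddFibs (rs z<x) z<x mp′
... | j , z≡ , x≡ = suc j , trans x≡ (sym (fib-+2*suc 1 j)) , trans y≡ (sym (fib-+2*suc 3 j))
  where
  y≡ : y ≡ fib (5 + 2 * j)
  y≡ = +-cancelʳ-≡ z y (fib (5 + 2 * j)) (begin
    y + z                             ≡⟨ y+z≡3x ⟩
    3 * x                             ≡⟨ cong (3 *_) x≡ ⟩
    3 * fib (3 + 2 * j)               ≡⟨ fib[m]+fib[4+m]≡3*fib[2+m] (1 + 2 * j) ⟨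
    fib (1 + 2 * j) + fib (5 + 2 * j) ≡⟨ +-comm (fib (1 + 2 * j)) (fib (5 + 2 * j)) ⟩
    fib (5 + 2 * j) + fib (1 + 2 * j) ≡⟨ cong (fib (5 + 2 * j) +_) z≡ ⟨
    fib (5 + 2 * j) + z               ∎)
    where open ≡-Reasoning

1+n<3*n : ∀ {n} → 0 < n → 1 + n < 3 * n
1+n<3*n {n} 0<n = begin-strict
  1 + n         ≤⟨ +-monoˡ-≤ n 0<n ⟩
  n + n         <⟨ m<m+n (n + n) 0<n ⟩
  n + n + n     ≡⟨ n+n+n≡3*n n ⟩
  3 * n         ∎
  where
  open ≤-Reasoning
  n+n+n≡3*n : ∀ n → n + n + n ≡ 3 * n
  n+n+n≡3*n = solve-∀

σ₂<≡3*⇒oddFibPrimes : ∀ {n} → 0 < n → σ₂< n ≡ 3 * n →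
  ∃[ j ] (Prime (fib (1 + 2 * j)) × Prime (fib (3 + 2 * j)) × n ≡ fib (1 + 2 * j) * fib (3 + 2 * j))
σ₂<≡3*⇒oddFibPrimes 0<n eq with σ₂<≡3*⇒semiprime 0<n eq
... | p , q , pp , pq , p≤q , refl with m≤n⇒m<n∨m≡n p≤q
... | inj₂ refl =
  contradiction (trans (sym (σ₂<-prime² pp)) eq) (<⇒≢ (1+n<3*n (*-mono-< 0<p 0<p)))
  where
  0<p : 0 < p
  0<p = <-trans z<s (prime⇒>1 pp)
... | inj₁ p<q
  with markovPair⇒oddFibs (<-wellFounded p) p<q (markov (trans (sym (σ₂<-prime*prime pp pq p<q)) eq))
... | j , refl , refl = j , pp , pq , refl

oddFibPrimes⇒σ₂<≡3* : ∀ j → Prime (fib (1 + 2 * j)) → Prime (fib (3 + 2 * j)) →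
  σ₂< (fib (1 + 2 * j) * fib (3 + 2 * j)) ≡ 3 * (fib (1 + 2 * j) * fib (3 + 2 * j))
oddFibPrimes⇒σ₂<≡3* j pp pq =
  trans (σ₂<-prime*prime pp pq (fib[1+m]<fib[3+m] (2 * j))) (MarkovPair.equation (oddFibs-markovPair j))

theorem2 : (n : ℕ) → 0 < n →
    ((σ₂ n ∸ n ^ 2 ≡ 3 * n) ⇔
     (∃[ k ] (k ≥ 1 × Prime (fib (2 * k ∸ 1)) × Prime (fib (2 * k + 1))
              × n ≡ fib (2 * k ∸ 1) * fib (2 * k + 1))))
theorem2 n 0<n = mk⇔ forward backward
  where
  OddFibonacciPrimeProduct : Set
  OddFibonacciPrimeProduct = ∃[ k ] (k ≥ 1 × Prime (fib (2 * k ∸ 1)) × Prime (fib (2 * k + 1))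
                                     × n ≡ fib (2 * k ∸ 1) * fib (2 * k + 1))

  fib[2k∸1] : ∀ j → fib (2 * suc j ∸ 1) ≡ fib (1 + 2 * j)
  fib[2k∸1] j = cong (λ i → fib (i ∸ 1)) (*-suc 2 j)

  fib[2k+1] : ∀ j → fib (2 * suc j + 1) ≡ fib (3 + 2 * j)
  fib[2k+1] j = trans (cong fib (+-comm (2 * suc j) 1)) (fib-+2*suc 1 j)

  forward : σ₂ n ∸ n ^ 2 ≡ 3 * n → OddFibonacciPrimeProduct
  forward eq with σ₂<≡3*⇒oddFibPrimes 0<n (trans (sym (σ₂∸n²≡σ₂< 0<n)) eq)
  ... | j , pp , pq , n≡ = suc j , s≤s z≤n , subst Prime (sym (fib[2k∸1] j)) pp ,
    subst Prime (sym (fib[2k+1] j)) pq , trans n≡ (sym (cong₂ _*_ (fib[2k∸1] j) (fib[2k+1] j)))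

  backward : OddFibonacciPrimeProduct → σ₂ n ∸ n ^ 2 ≡ 3 * n
  backward (suc j , _ , pp , pq , n≡) = trans (σ₂∸n²≡σ₂< 0<n)
    (subst (λ m → σ₂< m ≡ 3 * m) (sym (trans n≡ (cong₂ _*_ (fib[2k∸1] j) (fib[2k+1] j))))
      (oddFibPrimes⇒σ₂<≡3* j (subst Prime (fib[2k∸1] j) pp) (subst Prime (fib[2k+1] j) pq)))
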